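{- If $P$ and $Q$ are both $\mathbf{R1}$-healthy and $\mathbf{R2}_c$-healthy (i.e. $\mathbf{R1}(P) = P$, $\mathbf{R2}_c(P) = P$, $\mathbf{R1}(Q) = Q$, $\mathbf{R2}_c(Q) = Q$), then $$P \,;\, Q = \exists t_1, t_2 \in \mathcal{T}.\ \big((P[\langle\rangle, t_1/tr, tr'] \,;\, Q[\langle\rangle, t_2 / tr, tr']) \land tr' = tr \frown t_1 \frown t_2\big).$$
   Context: Fix a trace algebra $(\mathcal{T}, \frown, \langle\rangle)$: a set with associative $\frown$, two-sided unit $\langle\rangle$, left and right cancellation, and $x \frown y = \langle\rangle \Rightarrow x = \langle\rangle$. Prefix: $x \le y \iff \exists z.\ y = x \frown z$; subtraction: $y - x$ is the unique $z$ with $y = x \frown z$ if $x \le y$, else $\langle\rangle$. Predicates are relations (formulas identified up to logical equivalence) over unprimed variables $v$ and primed variables $v'$, including $tr, tr' : \mathcal{T}$ and other state variables; $t_1, t_2$ are fresh logical variables. Sequential composition: $P \,;\, Q \triangleq \exists v_0.\ P[v_0/v'] \land Q[v_0/v]$, where $v_0$ ranges over values of all variables. Conditional: $P \lhd b \rhd Q \triangleq (b \land P) \lor (\lnot b \land Q)$. $\mathbf{R1}(P) \triangleq P \land tr \le tr'$; $\mathbf{R2}_c(P) \triangleq P[\langle\rangle, tr' - tr / tr, tr'] \lhd tr \le tr' \rhd P$. -}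

module Defs where

open import Data.Product using (Σ; ∃; ∃-syntax; _×_; _,_; proj₁; proj₂)
open import Data.Sum using (_⊎_)
open import Relation.Nullary using (¬_)
open import Relation.Binary.PropositionalEquality using (_≡_)
open import Function.Bundles using (_⇔_)

-- Prefix and subtraction are as in the paper; subtraction is carried as an
-- operation together with its defining specification (it is uniquely
-- determined by left cancellation).
record TraceAlgebra : Set₁ where
  infixl 6 _⌢_
  infix 4 _≼_
  field
    𝒯      : Set
    _⌢_    : 𝒯 → 𝒯 → 𝒯
    ⟨⟩     : 𝒯
    assoc  : ∀ x y z → (x ⌢ y) ⌢ z ≡ x ⌢ (y ⌢ z)
    idˡ    : ∀ x → ⟨⟩ ⌢ x ≡ x
    idʳ    : ∀ x → x ⌢ ⟨⟩ ≡ x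
    cancelˡ : ∀ x y z → x ⌢ y ≡ x ⌢ z → y ≡ z
    cancelʳ : ∀ x y z → x ⌢ z ≡ y ⌢ z → x ≡ y
    positive : ∀ x y → x ⌢ y ≡ ⟨⟩ → x ≡ ⟨⟩

  _≼_ : 𝒯 → 𝒯 → Set
  x ≼ y = ∃[ z ] (y ≡ x ⌢ z)

  field
    _-_    : 𝒯 → 𝒯 → 𝒯
    minus-≼ : ∀ x y → x ≼ y → y ≡ x ⌢ (y - x)
    minus-⋠ : ∀ x y → ¬ (x ≼ y) → y - x ≡ ⟨⟩

module Reactive (TA : TraceAlgebra) (S : Set) where
  open TraceAlgebra TA

  -- an observation: value of tr together with the values of all other
  -- state variables (of type S)
  Obs : Set
  Obs = 𝒯 × S

  -- a predicate relates unprimed (v) and primed (v') observations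
  Pred : Set₁
  Pred = Obs → Obs → Set

  infix 4 _≐_
  _≐_ : Pred → Pred → Set
  P ≐ Q = ∀ v v' → P v v' ⇔ Q v v'

  infixr 5 _⨾_
  _⨾_ : Pred → Pred → Pred
  (P ⨾ Q) v v' = ∃[ v₀ ] (P v v₀ × Q v₀ v')

  cond : Pred → Pred → Pred → Pred
  cond P b Q v v' = (b v v' × P v v') ⊎ (¬ b v v' × Q v v')

  subst-tr : Pred → 𝒯 → 𝒯 → Pred
  subst-tr P a b (_ , s) (_ , s') = P (a , s) (b , s')

  tr≤tr' : Pred
  tr≤tr' (t , _) (t' , _) = t ≼ t'

  R1 : Pred → Pred
  R1 P v v' = P v v' × tr≤tr' v v'

  R2c : Pred → Pred
  R2c P = cond (λ v v' → subst-tr P ⟨⟩ (proj₁ v' - proj₁ v) v v') tr≤tr' P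

  seqR : Pred → Pred → Pred
  seqR P Q v v' = ∃[ t₁ ] ∃[ t₂ ]
    ((subst-tr P ⟨⟩ t₁ ⨾ subst-tr Q ⟨⟩ t₂) v v' × proj₁ v' ≡ proj₁ v ⌢ t₁ ⌢ t₂)

-- A healthy P relates (t, s) to (t', s') exactly when t ≼ t' and P relates
-- (⟨⟩, s) to (t' - t, s'): P only sees the trace extension it contributes.
-- So an intermediate observation (t₀, s₀) of P ⨾ Q splits the overall
-- extension as t₁ = t₀ - t followed by t₂ = t' - t₀; conversely, given t₁ and
-- t₂, the intermediate observation is (t ⌢ t₁, s₀).
module Submission where

open import Defs
open import Data.Product using (∃-syntax; _×_; _,_; proj₁; proj₂)
open import Data.Sum using (inj₁; inj₂)
open import Data.Empty using (⊥-elim)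
open import Relation.Binary.PropositionalEquality
  using (_≡_; refl; sym; trans; cong; subst)
open import Function.Bundles using (mk⇔; Equivalence)

module TraceAlgebraProperties (TA : TraceAlgebra) where
  open TraceAlgebra TA

  ⌢-minus : ∀ t u → (t ⌢ u) - t ≡ u
  ⌢-minus t u = sym (cancelˡ t u _ (minus-≼ t (t ⌢ u) (u , refl)))

  ≼-split : ∀ {t t₀ t'} → t ≼ t₀ → t₀ ≼ t' → t' ≡ t ⌢ (t₀ - t) ⌢ (t' - t₀)
  ≼-split {t} {t₀} {t'} t≼t₀ t₀≼t' =
    trans (minus-≼ t₀ t' t₀≼t') (cong (_⌢ (t' - t₀)) (minus-≼ t t₀ t≼t₀))

module HealthinessProperties (TA : TraceAlgebra) (S : Set) where
  open TraceAlgebra TA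
  open Reactive TA S
  open TraceAlgebraProperties TA

  R1-≼ : ∀ {P} → R1 P ≐ P → ∀ {t s t' s'} → P (t , s) (t' , s') → t ≼ t'
  R1-≼ r1 p = proj₂ (Equivalence.from (r1 _ _) p)

  R2c-unshift : ∀ {P} → R2c P ≐ P → ∀ {t s t' s'} → t ≼ t' →
                P (t , s) (t' , s') → P (⟨⟩ , s) (t' - t , s')
  R2c-unshift r2 t≼t' p with Equivalence.from (r2 _ _) p
  ... | inj₁ (_ , p⟨⟩) = p⟨⟩
  ... | inj₂ (t⋠t' , _) = ⊥-elim (t⋠t' t≼t')

  R2c-shift : ∀ {P} → R2c P ≐ P → ∀ {s s'} t {u} →
              P (⟨⟩ , s) (u , s') → P (t , s) (t ⌢ u , s')
  R2c-shift {P} r2 {s} {s'} t {u} p = Equivalence.to (r2 _ _)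
    (inj₁ ((u , refl) , subst (λ z → P (⟨⟩ , s) (z , s')) (sym (⌢-minus t u)) p))

  ⨾⇒seqR : ∀ {P Q} → R1 P ≐ P → R2c P ≐ P → R1 Q ≐ Q → R2c Q ≐ Q →
           ∀ v v' → (P ⨾ Q) v v' → seqR P Q v v'
  ⨾⇒seqR p1 p2 q1 q2 (t , s) (t' , s') ((t₀ , s₀) , p , q) =
    t₀ - t , t' - t₀ ,
    ((t₀ , s₀) , R2c-unshift p2 t≼t₀ p , R2c-unshift q2 t₀≼t' q) ,
    ≼-split t≼t₀ t₀≼t'
    where
    t≼t₀ : t ≼ t₀
    t≼t₀ = R1-≼ p1 p
    t₀≼t' : t₀ ≼ t'
    t₀≼t' = R1-≼ q1 q

  seqR⇒⨾ : ∀ {P Q} → R2c P ≐ P → R2c Q ≐ Q →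
           ∀ v v' → seqR P Q v v' → (P ⨾ Q) v v'
  seqR⇒⨾ {Q = Q} p2 q2 (t , s) (t' , s') (t₁ , t₂ , ((_ , s₀) , p , q) , t'≡) =
    (t ⌢ t₁ , s₀) , R2c-shift p2 t p ,
    subst (λ z → Q (t ⌢ t₁ , s₀) (z , s')) (sym t'≡) (R2c-shift q2 (t ⌢ t₁) q)

theorem11 : (TA : TraceAlgebra) (S : Set) (P Q : Reactive.Pred TA S) →
    Reactive._≐_ TA S (Reactive.R1 TA S P) P → Reactive._≐_ TA S (Reactive.R2c TA S P) P →
    Reactive._≐_ TA S (Reactive.R1 TA S Q) Q → Reactive._≐_ TA S (Reactive.R2c TA S Q) Q →
    Reactive._≐_ TA S (Reactive._⨾_ TA S P Q) (Reactive.seqR TA S P Q)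
theorem11 TA S P Q p1 p2 q1 q2 v v' =
  mk⇔ (⨾⇒seqR p1 p2 q1 q2 v v') (seqR⇒⨾ p2 q2 v v')
  where open HealthinessProperties TA S
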